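{- Let $D$ be a digraph, let $u\ne v\in V(D)$, and let $P$ be a directed $uv$-path in $D$. Then $\lambda(D+uv-A(P))\le\lambda(D)$, where $D+uv-A(P)$ is the digraph with vertex set $V(D)$ and arc set $(A(D)\cup\{uv\})\setminus A(P)$.
   Context: Digraphs are finite, without loops or parallel arcs. $\lambda_D(x,y)$ is the maximum number of pairwise arc-disjoint directed $xy$-paths and $\lambda(D)=\max_{x\ne y}\lambda_D(x,y)$. -}

module Defs where

open import Data.Nat using (ℕ)
open import Data.Fin using (Fin)
open import Data.List using (List; []; _∷_)
open import Data.List.Relation.Unary.Unique.Propositional using (Unique)
open import Data.Product using (Σ; _×_; _,_; ∃; ∃-syntax; proj₁)
open import Data.Sum using (_⊎_)
open import Relation.Binary.PropositionalEquality using (_≡_)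
open import Relation.Nullary using (¬_)

-- A digraph on the vertex set Fin n: an arc relation without loops.
-- (Parallel arcs are irrelevant: paths are recorded by their vertex
-- sequences and arcs are compared as ordered pairs of vertices.)
record Digraph (n : ℕ) : Set₁ where
  field
    Arc      : Fin n → Fin n → Set
    loopless : ∀ x → ¬ Arc x x
open Digraph public

data Chain {n : ℕ} (A : Fin n → Fin n → Set) : Fin n → Fin n → List (Fin n) → Set where
  stop : ∀ {x} → Chain A x x (x ∷ [])
  step : ∀ {x z y vs} → A x z → Chain A z y vs → Chain A x y (x ∷ vs)

Path : ∀ {n} → Digraph n → Fin n → Fin n → Set
Path {n} D x y = Σ (List (Fin n)) λ vs → Chain (Arc D) x y vs × Unique vs

data ArcOfSeq {n : ℕ} (a b : Fin n) : List (Fin n) → Set where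
  here  : ∀ {vs} → ArcOfSeq a b (a ∷ b ∷ vs)
  there : ∀ {c vs} → ArcOfSeq a b vs → ArcOfSeq a b (c ∷ vs)

ArcOfPath : ∀ {n} {D : Digraph n} {x y : Fin n} → Path D x y → Fin n → Fin n → Set
ArcOfPath {D = D} {x} {y} P a b = ArcOfSeq a b (proj₁ P)

addRemove : ∀ {n} (D : Digraph n) (u v : Fin n) → ¬ (u ≡ v) →
            Path D u v → Digraph n
addRemove D u v u≢v P = record
  { Arc      = λ a b → (Arc D a b ⊎ (a ≡ u × b ≡ v)) × ¬ ArcOfPath {D = D} P a b
  ; loopless = loopless'
  }
  where
  open import Relation.Binary.PropositionalEquality using (trans; sym)
  loopless' : ∀ x → ¬ ((Arc D x x ⊎ (x ≡ u × x ≡ v)) × ¬ ArcOfPath {D = D} P x x)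
  loopless' x (Data.Sum.inj₁ a , _) = loopless D x a
  loopless' x (Data.Sum.inj₂ (p , q) , _) = u≢v (trans (sym p) q)

ArcDisjointPaths : ∀ {n} → Digraph n → Fin n → Fin n → ℕ → Set
ArcDisjointPaths D x y k =
  Σ (Fin k → Path D x y) λ P →
    ∀ i j → ¬ (i ≡ j) → ∀ a b → ¬ (ArcOfPath {D = D} (P i) a b × ArcOfPath {D = D} (P j) a b)

-- λ(D) ≥ k : some pair x ≠ y admits k pairwise arc-disjoint xy-paths.
LambdaAtLeast : ∀ {n} → Digraph n → ℕ → Set
LambdaAtLeast D k = ∃[ x ] ∃[ y ] (¬ (x ≡ y) × ArcDisjointPaths D x y k)

-- Reroute each of the k arc-disjoint xy-paths of D + uv - A(P) through P
-- whenever it uses the arc uv, and shortcut the resulting walk in D to a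
-- path. An arc of a rerouted path comes from its own original path, whose
-- arcs avoid A(P), or from P, which is used only by the at most one path
-- traversing uv; so the rerouted paths are again pairwise arc-disjoint.
module Submission where

open import Defs
open import Data.Nat using (ℕ)
open import Data.Fin using (Fin)
open import Data.Fin.Properties using (_≟_)
open import Data.List using (List; []; _∷_)
open import Data.List.Membership.Propositional using (_∈_)
open import Data.List.Relation.Unary.All using ([])
open import Data.List.Relation.Unary.All.Properties using (¬Any⇒All¬)
open import Data.List.Relation.Unary.AllPairs using ([]; _∷_)
open import Data.List.Relation.Unary.Any using (here; there)
open import Data.List.Relation.Unary.Unique.Propositional using (Unique)
open import Data.Product using (Σ; _×_; _,_; proj₁; proj₂)
import Data.Product as Product
open import Data.Sum using (_⊎_; inj₁; inj₂)
import Data.Sum as Sum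
open import Relation.Binary.PropositionalEquality using (_≡_; refl)
open import Relation.Nullary using (¬_; yes; no)

private
  variable
    n : ℕ
    a b u v x y z : Fin n
    ps vs ws : List (Fin n)

_⊆ᵃ_ : List (Fin n) → List (Fin n) → Set
ws ⊆ᵃ vs = ∀ {a b} → ArcOfSeq a b ws → ArcOfSeq a b vs

ArcDisjoint : List (Fin n) → List (Fin n) → Set
ArcDisjoint {n} vs ws = ∀ (a b : Fin n) → ¬ (ArcOfSeq a b vs × ArcOfSeq a b ws)

Rerouted : Fin n → Fin n → List (Fin n) → List (Fin n) → List (Fin n) → Set
Rerouted u v ps ws vs =
  ∀ {a b} → ArcOfSeq a b ws → ArcOfSeq a b vs ⊎ (ArcOfSeq u v vs × ArcOfSeq a b ps)

rerouted-arcDisjoint : ∀ {ws₁ ws₂ vs₁ vs₂ : List (Fin n)} →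
  ArcDisjoint vs₁ vs₂ → ArcDisjoint vs₁ ps → ArcDisjoint vs₂ ps →
  Rerouted u v ps ws₁ vs₁ → Rerouted u v ps ws₂ vs₂ → ArcDisjoint ws₁ ws₂
rerouted-arcDisjoint {u = u} {v} disj₁₂ disj₁ disj₂ rer₁ rer₂ a b (p₁ , p₂)
  with rer₁ p₁ | rer₂ p₂
... | inj₁ q₁        | inj₁ q₂        = disj₁₂ a b (q₁ , q₂)
... | inj₁ q₁        | inj₂ (_ , r₂)  = disj₁ a b (q₁ , r₂)
... | inj₂ (_ , r₁)  | inj₁ q₂        = disj₂ a b (q₂ , r₁)
... | inj₂ (uv₁ , _) | inj₂ (uv₂ , _) = disj₁₂ u v (uv₁ , uv₂)

AddArc : (Fin n → Fin n → Set) → Fin n → Fin n → Fin n → Fin n → Set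
AddArc A u v a b = A a b ⊎ (a ≡ u × b ≡ v)

chain-map : ∀ {A B : Fin n → Fin n → Set} → (∀ {a b} → A a b → B a b) →
            Chain A x y vs → Chain B x y vs
chain-map f stop       = stop
chain-map f (step d c) = step (f d) (chain-map f c)

arcOf-head : ∀ {A : Fin n → Fin n → Set} → Chain A z y ws → ArcOfSeq x z (x ∷ ws)
arcOf-head stop       = here
arcOf-head (step _ _) = here

arcOf-∷ : ∀ {A : Fin n → Fin n → Set} → Chain A z y ws →
          ArcOfSeq a b (x ∷ ws) → (a ≡ x × b ≡ z) ⊎ ArcOfSeq a b ws
arcOf-∷ stop       here      = inj₁ (refl , refl)
arcOf-∷ stop       (there p) = inj₂ p
arcOf-∷ (step _ _) here      = inj₁ (refl , refl)
arcOf-∷ (step _ _) (there p) = inj₂ p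

module _ {A : Fin n → Fin n → Set} where

  open import Data.List.Membership.DecPropositional (_≟_ {n}) using (_∈?_)

  ∷-⊆ᵃ : Chain A z y ws → Chain A z y vs → ws ⊆ᵃ vs → (x ∷ ws) ⊆ᵃ (x ∷ vs)
  ∷-⊆ᵃ ch c sub p with arcOf-∷ ch p
  ... | inj₁ (refl , refl) = arcOf-head c
  ... | inj₂ q             = there (sub q)

  chain-arc : Chain A x y vs → ArcOfSeq a b vs → A a b
  chain-arc stop       (there ())
  chain-arc (step d c) p with arcOf-∷ c p
  ... | inj₁ (refl , refl) = d
  ... | inj₂ q             = chain-arc c q

  chain-++ : Chain A x z vs → Chain A z y ws →
             Σ (List (Fin n)) λ rs → Chain A x y rs ×
               (∀ {a b} → ArcOfSeq a b rs → ArcOfSeq a b vs ⊎ ArcOfSeq a b ws)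
  chain-++ stop       c′ = _ , c′ , inj₂
  chain-++ (step d c) c′ with chain-++ c c′
  ... | rs , rch , arcs = _ , step d rch , arcs′
    where
    arcs′ : ∀ {a b} → ArcOfSeq a b (_ ∷ rs) → _
    arcs′ p with arcOf-∷ rch p
    ... | inj₁ (refl , refl) = inj₁ (arcOf-head c)
    ... | inj₂ q             = Sum.map₁ there (arcs q)

  chain-suffix : Chain A z y ws → Unique ws → x ∈ ws →
                 Σ (List (Fin n)) λ ts → Chain A x y ts × Unique ts × ts ⊆ᵃ ws
  chain-suffix stop       uq       (here refl) = _ , stop , uq , λ p → p
  chain-suffix stop       _        (there ())
  chain-suffix (step d c) uq       (here refl) = _ , step d c , uq , λ p → p
  chain-suffix (step _ c) (_ ∷ uq) (there x∈) with chain-suffix c uq x∈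
  ... | ts , tch , tu , sub = ts , tch , tu , λ p → there (sub p)

  -- Cut out the closed subwalk between two visits of the same vertex.
  chain⇒unique : Chain A x y vs →
                 Σ (List (Fin n)) λ ws → Chain A x y ws × Unique ws × ws ⊆ᵃ vs
  chain⇒unique stop = _ , stop , [] ∷ [] , λ p → p
  chain⇒unique (step {x = x} d c) with chain⇒unique c
  ... | ws , wch , wu , sub with x ∈? ws
  ...   | no x∉  = x ∷ ws , step d wch , ¬Any⇒All¬ ws x∉ ∷ wu , ∷-⊆ᵃ wch c sub
  ...   | yes x∈ with chain-suffix wch wu x∈
  ...     | ts , tch , tu , sub′ = ts , tch , tu , λ p → there (sub (sub′ p))

  chain-reroute : Chain A u v ps → Chain (AddArc A u v) x y vs →
                  Σ (List (Fin n)) λ ws → Chain A x y ws × Rerouted u v ps ws vs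
  chain-reroute pch stop = _ , stop , λ { (there ()) }
  chain-reroute pch (step (inj₁ d) c) with chain-reroute pch c
  ... | ws , wch , rer = _ , step d wch , rer′
    where
    rer′ : Rerouted _ _ _ (_ ∷ ws) _
    rer′ p with arcOf-∷ wch p
    ... | inj₁ (refl , refl) = inj₁ (arcOf-head c)
    ... | inj₂ q             = Sum.map there (Product.map₁ there) (rer q)
  chain-reroute pch (step (inj₂ (refl , refl)) c) with chain-reroute pch c
  ... | ws , wch , rer with chain-++ pch wch
  ...   | rs , rch , arcs = rs , rch , rer′
    where
    rer′ : Rerouted _ _ _ rs _
    rer′ p with arcs p
    ... | inj₁ r = inj₂ (arcOf-head c , r)
    ... | inj₂ q = Sum.map there (Product.map₁ there) (rer q)

module _ (D : Digraph n) (u v : Fin n) (u≢v : ¬ u ≡ v) (P : Path D u v) where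

  private
    D′ : Digraph n
    D′ = addRemove D u v u≢v P

  reroute-path : (Q : Path D′ x y) →
                 Σ (Path D x y) λ R → Rerouted u v (proj₁ P) (proj₁ R) (proj₁ Q)
  reroute-path (_ , qch , _) with chain-reroute (proj₁ (proj₂ P)) (chain-map proj₁ qch)
  ... | ws , wch , rer with chain⇒unique wch
  ...   | ts , tch , tu , sub = (ts , tch , tu) , λ p → rer (sub p)

  avoids-removed-path : (Q : Path D′ x y) → ArcDisjoint (proj₁ Q) (proj₁ P)
  avoids-removed-path (_ , qch , _) a b (q , p) = proj₂ (chain-arc qch q) p

lemma3p5 : ∀ {n : ℕ} (D : Digraph n) (u v : Fin n) (u≢v : ¬ (u ≡ v))
             (P : Path D u v) (k : ℕ) →
             LambdaAtLeast (addRemove D u v u≢v P) k → LambdaAtLeast D k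
lemma3p5 D u v u≢v P k (x , y , x≢y , Qs , disjoint) =
  x , y , x≢y , (λ i → proj₁ (rerouted i)) , disjoint′
  where
  rerouted : ∀ i → Σ (Path D x y) λ R → Rerouted u v (proj₁ P) (proj₁ R) (proj₁ (Qs i))
  rerouted i = reroute-path D u v u≢v P (Qs i)

  disjoint′ : ∀ i j → ¬ i ≡ j →
              ArcDisjoint (proj₁ (proj₁ (rerouted i))) (proj₁ (proj₁ (rerouted j)))
  disjoint′ i j i≢j = rerouted-arcDisjoint (disjoint i j i≢j)
    (avoids-removed-path D u v u≢v P (Qs i)) (avoids-removed-path D u v u≢v P (Qs j))
    (proj₂ (rerouted i)) (proj₂ (rerouted j))
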